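{- Let $n \in \mathbb{N}$ and suppose there is a long-refinement graph $G$ with $|G| = n$. If there is a $d \in \mathbb{N}$ with $\deg(G) = \{d, d+1\}$ such that $|\{v \in V(G) \mid \deg(v) = d\}| \neq d+1$, then there is also a long-refinement graph $G'$ with $|G'| = n+1$.
   Context: All graphs are finite, simple, undirected, with monochromatic initial colouring. Colour Refinement computes $\chi^0_G$ constant and $\chi^i_G(v) = \big(\chi^{i-1}_G(v), \{\!\{\chi^{i-1}_G(w) \mid w \in N(v)\}\!\}\big)$; $\pi^i_G$ is the partition of $V(G)$ into colour classes of $\chi^i_G$, and $\mathrm{WL}_1(G)$ is the least $j \geq 0$ with $\pi^j_G = \pi^{j+1}_G$. A long-refinement graph is a graph $G$ with $\mathrm{WL}_1(G) = |G|-1$; $\deg(G) = \{\deg(v) \mid v \in V(G)\}$. -}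

module Defs where

open import Data.Bool using (Bool; true; false; _∧_; if_then_else_)
open import Data.Nat using (ℕ; zero; suc; _<_; _≡ᵇ_)
open import Data.Fin using (Fin)
open import Data.List using (List; allFin; map)
open import Data.Nat.ListAction using (sum)
open import Data.Bool.ListAction using (and)
open import Data.Product using (Σ; _×_; ∃)
open import Data.Sum using (_⊎_)
open import Relation.Binary.PropositionalEquality using (_≡_; _≢_)
open import Relation.Nullary using (¬_)

record Graph (n : ℕ) : Set where
  field
    adj   : Fin n → Fin n → Bool
    sym   : ∀ v w → adj v w ≡ adj w v
    irrefl : ∀ v → adj v v ≡ false
open Graph public

count : ∀ {n} → (Fin n → Bool) → ℕ
count {n} p = sum (map (λ x → if p x then 1 else 0) (allFin n))

allV : ∀ {n} → (Fin n → Bool) → Bool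
allV {n} p = and (map p (allFin n))

deg : ∀ {n} → Graph n → Fin n → ℕ
deg G v = count (adj G v)

-- sameColour G i v w = true  iff  χ^i_G(v) = χ^i_G(w).  Round i+1: same colour at round i and the
-- multisets {{ χ^i(x) | x ∈ N(.) }} agree, i.e. for every colour class
-- of χ^i (each represented by some vertex u) v and w have the same number
-- of neighbours in that class.
sameColour : ∀ {n} → Graph n → ℕ → Fin n → Fin n → Bool
sameColour G zero    v w = true
sameColour G (suc i) v w =
  sameColour G i v w ∧
  allV (λ u → count (λ x → adj G v x ∧ sameColour G i x u)
           ≡ᵇ count (λ x → adj G w x ∧ sameColour G i x u))

Stable : ∀ {n} → Graph n → ℕ → Set
Stable G j = ∀ v w → sameColour G j v w ≡ sameColour G (suc j) v w

WL₁≡ : ∀ {n} → Graph n → ℕ → Set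
WL₁≡ G k = Stable G k × (∀ j → j < k → ¬ Stable G j)

-- long-refinement graph: WL₁(G) = |G| - 1  (stated as WL₁(G) + 1 = |G|,
-- so that the empty graph is not a long-refinement graph)
IsLongRefinement : ∀ {n} → Graph n → Set
IsLongRefinement {n} G = Σ ℕ λ k → WL₁≡ G k × suc k ≡ n

DegSet : ∀ {n} → Graph n → ℕ → Set
DegSet G d = (∀ v → deg G v ≡ d ⊎ deg G v ≡ suc d)
           × (∃ λ v → deg G v ≡ d) × (∃ λ v → deg G v ≡ suc d)

module Submission where

-- Let G be a long-refinement graph with deg(G) = {d, d+1} and
-- suppose the number c of degree-d vertices differs from d+1.  Add an apex
-- vertex adjacent to exactly the degree-d vertices.  In the new graph G⁺ every
-- old vertex has degree d+1 while the apex has degree c ≠ d+1, so the first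
-- refinement round separates the apex from everything else and afterwards the
-- apex forms a singleton class adjacent to the same old vertices as before.
-- Consequently the colouring of the old vertices in round i+1 of G⁺ is exactly
-- the colouring of G in round i, so WL₁(G⁺) = WL₁(G) + 1 = |G⁺| - 1.

open import Defs
open import Data.Nat using (ℕ; suc; _≡ᵇ_)
open import Data.Product using (Σ; _×_)
open import Relation.Binary.PropositionalEquality using (_≢_)

open import Data.Nat using (zero; _+_; _<_; s≤s; _≟_)
open import Data.Nat.Properties using (≡ᵇ⇒≡; 1+n≢n; +-cancelʳ-≡; +-identityʳ)
open import Data.Fin using (Fin) renaming (zero to fz; suc to fs)
open import Data.Bool using (Bool; true; false; _∧_; if_then_else_)
open import Data.Bool.Properties using (T-≡; ∧-zeroʳ; ∧-identityʳ)
open import Data.List using (foldr; allFin)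
open import Data.List.Properties using (map-tabulate; map-cong)
open import Data.Nat.ListAction using (sum)
open import Data.Product using (_,_)
open import Data.Sum using (inj₁; inj₂)
open import Function using (id; _∘′_; Equivalence)
open import Relation.Binary.PropositionalEquality
  using (_≡_; refl; trans; cong; cong₂; module ≡-Reasoning)
  renaming (sym to ≡-sym)
open import Relation.Nullary using (¬_)
open import Relation.Nullary.Decidable using (dec-true; dec-false)

≡ᵇ-complete : ∀ {m n} → m ≡ n → (m ≡ᵇ n) ≡ true
≡ᵇ-complete {m} {n} = dec-true (m ≟ n)

≡ᵇ-false : ∀ {m n} → m ≢ n → (m ≡ᵇ n) ≡ false
≡ᵇ-false {m} {n} = dec-false (m ≟ n)

≡ᵇ-sound : ∀ {m n} → (m ≡ᵇ n) ≡ true → m ≡ n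
≡ᵇ-sound {m} {n} e = ≡ᵇ⇒≡ m n (Equivalence.from T-≡ e)

∧-left : ∀ {a b} → (a ∧ b) ≡ true → a ≡ true
∧-left {true} _ = refl

∧-drop-implied : ∀ b c e → ((b ∧ e) ≡ true → c ≡ true) → (b ∧ (c ∧ e)) ≡ (b ∧ e)
∧-drop-implied false c e _ = refl
∧-drop-implied true  c false _ = ∧-zeroʳ c
∧-drop-implied true  c true  h rewrite h refl = refl

indicator : Bool → ℕ
indicator b = if b then 1 else 0

count-suc : ∀ {n} (p : Fin (suc n) → Bool) →
  count p ≡ indicator (p fz) + count (λ x → p (fs x))
count-suc p = cong (indicator (p fz) +_) (cong sum
  (trans (map-tabulate fs (λ x → indicator (p x)))
         (≡-sym (map-tabulate id (λ x → indicator (p (fs x)))))))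

count-cong : ∀ {n} {p q : Fin n → Bool} → (∀ x → p x ≡ q x) → count p ≡ count q
count-cong {n} e = cong sum (map-cong (λ x → cong indicator (e x)) (allFin n))

count-false : ∀ n → count {n} (λ _ → false) ≡ 0
count-false zero    = refl
count-false (suc n) = trans (count-suc {n} (λ _ → false)) (count-false n)

allV-suc : ∀ {n} (p : Fin (suc n) → Bool) → allV p ≡ (p fz ∧ allV (λ x → p (fs x)))
allV-suc p = cong (p fz ∧_) (cong (foldr _∧_ true)
  (trans (map-tabulate fs p) (≡-sym (map-tabulate id (λ x → p (fs x))))))

allV-cong : ∀ {n} {p q : Fin n → Bool} → (∀ x → p x ≡ q x) → allV p ≡ allV q
allV-cong {n} e = cong (foldr _∧_ true) (map-cong e (allFin n))

allV-intro : ∀ {n} (p : Fin n → Bool) → (∀ u → p u ≡ true) → allV p ≡ true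
allV-intro {zero}  p h = refl
allV-intro {suc n} p h rewrite allV-suc p | h fz = allV-intro (λ x → p (fs x)) (λ u → h (fs u))

allV-const : ∀ {n} → Fin n → ∀ b → allV {n} (λ _ → b) ≡ b
allV-const {suc n} _ b rewrite allV-suc {n} (λ _ → b) with b
... | false = refl
... | true  = allV-intro {n} (λ _ → true) (λ _ → refl)

module _ {n : ℕ} (G : Graph n) where

  sameColour-refl : ∀ i v → sameColour G i v v ≡ true
  sameColour-refl zero    v = refl
  sameColour-refl (suc i) v rewrite sameColour-refl i v =
    allV-intro (λ u → neighbours u ≡ᵇ neighbours u) (λ u → ≡ᵇ-complete {neighbours u} refl)
    where
    neighbours : Fin n → ℕ
    neighbours u = count (λ x → adj G v x ∧ sameColour G i x u)

  sameColour-one : ∀ v w → sameColour G 1 v w ≡ (deg G v ≡ᵇ deg G w)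
  sameColour-one v w = begin
    allV {n} (λ _ → degTrue v ≡ᵇ degTrue w) ≡⟨ allV-const v _ ⟩
    (degTrue v ≡ᵇ degTrue w)                ≡⟨ cong₂ _≡ᵇ_ (degTrue≡deg v) (degTrue≡deg w) ⟩
    (deg G v ≡ᵇ deg G w)                    ∎
    where
    open ≡-Reasoning
    degTrue : Fin n → ℕ
    degTrue v = count (λ x → adj G v x ∧ true)
    degTrue≡deg : ∀ v → degTrue v ≡ deg G v
    degTrue≡deg v = count-cong (λ x → ∧-identityʳ (adj G v x))

  sameColour-deg : ∀ i v w → sameColour G (suc i) v w ≡ true → deg G v ≡ deg G w
  sameColour-deg zero    v w e = ≡ᵇ-sound (trans (≡-sym (sameColour-one v w)) e)
  sameColour-deg (suc i) v w e = sameColour-deg i v w (∧-left e)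

  degree-apart : ∀ {v w} → deg G v ≢ deg G w → ∀ i → sameColour G (suc i) v w ≡ false
  degree-apart {v} {w} ne zero    = trans (sameColour-one v w) (≡ᵇ-false ne)
  degree-apart         ne (suc i) rewrite degree-apart ne i = refl

apexAdj : ∀ {n} → Graph n → (Fin n → Bool) → Fin (suc n) → Fin (suc n) → Bool
apexAdj G p fz     fz     = false
apexAdj G p fz     (fs w) = p w
apexAdj G p (fs v) fz     = p v
apexAdj G p (fs v) (fs w) = adj G v w

addApex : ∀ {n} → Graph n → (Fin n → Bool) → Graph (suc n)
addApex G p = record { adj = apexAdj G p ; sym = symmetric ; irrefl = irreflexive }
  where
  symmetric : ∀ v w → apexAdj G p v w ≡ apexAdj G p w v
  symmetric fz     fz     = refl
  symmetric fz     (fs w) = refl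
  symmetric (fs v) fz     = refl
  symmetric (fs v) (fs w) = Graph.sym G v w
  irreflexive : ∀ v → apexAdj G p v v ≡ false
  irreflexive fz     = refl
  irreflexive (fs v) = Graph.irrefl G v

deg-apex : ∀ {n} (G : Graph n) p → deg (addApex G p) fz ≡ count p
deg-apex G p = count-suc (apexAdj G p fz)

deg-old : ∀ {n} (G : Graph n) p v → deg (addApex G p) (fs v) ≡ indicator (p v) + deg G v
deg-old G p v = count-suc (apexAdj G p (fs v))

-- If all old vertices get a common degree m in the extension and the apex does
-- not, then refinement on the extension lags exactly one round behind G.
module ApexShift {n : ℕ} (G : Graph n) (p : Fin n → Bool) (m : ℕ)
  (uniform : ∀ v → deg (addApex G p) (fs v) ≡ m)
  (apex-distinct : deg (addApex G p) fz ≢ m) where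

  G⁺ : Graph (suc n)
  G⁺ = addApex G p

  apex-apart : ∀ i v → sameColour G⁺ (suc i) fz (fs v) ≡ false
  apex-apart i v = degree-apart G⁺ (λ e → apex-distinct (trans e (uniform v))) i

  old-apart : ∀ i v → sameColour G⁺ (suc i) (fs v) fz ≡ false
  old-apart i v = degree-apart G⁺ (λ e → apex-distinct (trans (≡-sym e) (uniform v))) i

  p-respects-deg : ∀ {v w} → deg G v ≡ deg G w → indicator (p v) ≡ indicator (p w)
  p-respects-deg {v} {w} e = +-cancelʳ-≡ (deg G w) _ _ (begin
    indicator (p v) + deg G w ≡⟨ cong (indicator (p v) +_) (≡-sym e) ⟩
    indicator (p v) + deg G v ≡⟨ ≡-sym (deg-old G p v) ⟩
    deg G⁺ (fs v)             ≡⟨ trans (uniform v) (≡-sym (uniform w)) ⟩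
    deg G⁺ (fs w)             ≡⟨ deg-old G p w ⟩
    indicator (p w) + deg G w ∎)
    where open ≡-Reasoning

  -- Once the apex is a singleton class, an old vertex has a neighbour in it iff it lies in p.
  count-apex-class : ∀ i v →
    count (λ x → apexAdj G p (fs v) x ∧ sameColour G⁺ (suc i) x fz) ≡ indicator (p v)
  count-apex-class i v = begin
    count (λ x → apexAdj G p (fs v) x ∧ sameColour G⁺ (suc i) x fz)
      ≡⟨ count-suc (λ x → apexAdj G p (fs v) x ∧ sameColour G⁺ (suc i) x fz) ⟩
    indicator (p v ∧ sameColour G⁺ (suc i) fz fz)
      + count (λ y → adj G v y ∧ sameColour G⁺ (suc i) (fs y) fz)
      ≡⟨ cong₂ _+_ (cong (λ b → indicator (p v ∧ b)) (sameColour-refl G⁺ (suc i) fz))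
                   (count-cong (λ y → cong (adj G v y ∧_) (old-apart i y))) ⟩
    indicator (p v ∧ true) + count (λ y → adj G v y ∧ false)
      ≡⟨ cong₂ _+_ (cong indicator (∧-identityʳ (p v)))
                   (trans (count-cong (λ y → ∧-zeroʳ (adj G v y))) (count-false n)) ⟩
    indicator (p v) + 0
      ≡⟨ +-identityʳ (indicator (p v)) ⟩
    indicator (p v) ∎
    where open ≡-Reasoning

  count-old-class : ∀ i → (∀ x u → sameColour G⁺ (suc i) (fs x) (fs u) ≡ sameColour G i x u) →
    ∀ v u → count (λ x → apexAdj G p (fs v) x ∧ sameColour G⁺ (suc i) x (fs u))
          ≡ count (λ x → adj G v x ∧ sameColour G i x u)
  count-old-class i shift v u = begin
    count (λ x → apexAdj G p (fs v) x ∧ sameColour G⁺ (suc i) x (fs u))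
      ≡⟨ count-suc (λ x → apexAdj G p (fs v) x ∧ sameColour G⁺ (suc i) x (fs u)) ⟩
    indicator (p v ∧ sameColour G⁺ (suc i) fz (fs u))
      + count (λ x → adj G v x ∧ sameColour G⁺ (suc i) (fs x) (fs u))
      ≡⟨ cong₂ _+_ (cong (λ b → indicator (p v ∧ b)) (apex-apart i u))
                   (count-cong (λ x → cong (adj G v x ∧_) (shift x u))) ⟩
    indicator (p v ∧ false) + count (λ x → adj G v x ∧ sameColour G i x u)
      ≡⟨ cong (λ b → indicator b + count (λ x → adj G v x ∧ sameColour G i x u)) (∧-zeroʳ (p v)) ⟩
    count (λ x → adj G v x ∧ sameColour G i x u) ∎
    where open ≡-Reasoning

  colours-shift : ∀ i v w → sameColour G⁺ (suc i) (fs v) (fs w) ≡ sameColour G i v w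
  colours-shift zero    v w = trans (sameColour-one G⁺ (fs v) (fs w))
                                    (≡ᵇ-complete (trans (uniform v) (≡-sym (uniform w))))
  colours-shift (suc i) v w = begin
    sameColour G⁺ (suc i) (fs v) (fs w) ∧ allV refines⁺
      ≡⟨ cong₂ _∧_ (colours-shift i v w) (allV-suc refines⁺) ⟩
    sameColour G i v w ∧ (refines⁺ fz ∧ allV (λ u → refines⁺ (fs u)))
      ≡⟨ cong (λ b → sameColour G i v w ∧ b)
              (cong₂ _∧_ (cong₂ _≡ᵇ_ (count-apex-class i v) (count-apex-class i w))
                         (allV-cong (λ u → cong₂ _≡ᵇ_ (count-old-class i (colours-shift i) v u)
                                                       (count-old-class i (colours-shift i) w u)))) ⟩
    sameColour G i v w ∧ ((indicator (p v) ≡ᵇ indicator (p w)) ∧ allV refines)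
      ≡⟨ ∧-drop-implied (sameColour G i v w) (indicator (p v) ≡ᵇ indicator (p w)) (allV refines)
           (λ e → ≡ᵇ-complete (p-respects-deg (sameColour-deg G i v w e))) ⟩
    sameColour G i v w ∧ allV refines ∎
    where
    open ≡-Reasoning
    refines⁺ : Fin (suc n) → Bool
    refines⁺ u = count (λ x → apexAdj G p (fs v) x ∧ sameColour G⁺ (suc i) x u)
              ≡ᵇ count (λ x → apexAdj G p (fs w) x ∧ sameColour G⁺ (suc i) x u)
    refines : Fin n → Bool
    refines u = count (λ x → adj G v x ∧ sameColour G i x u)
             ≡ᵇ count (λ x → adj G w x ∧ sameColour G i x u)

  stable-up : ∀ j → Stable G j → Stable G⁺ (suc j)
  stable-up j st fz     fz     = trans (sameColour-refl G⁺ (suc j) fz)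
                                       (≡-sym (sameColour-refl G⁺ (suc (suc j)) fz))
  stable-up j st fz     (fs w) = trans (apex-apart j w) (≡-sym (apex-apart (suc j) w))
  stable-up j st (fs v) fz     = trans (old-apart j v) (≡-sym (old-apart (suc j) v))
  stable-up j st (fs v) (fs w) =
    trans (colours-shift j v w) (trans (st v w) (≡-sym (colours-shift (suc j) v w)))

  stable-down : ∀ j → Stable G⁺ (suc j) → Stable G j
  stable-down j st v w =
    trans (≡-sym (colours-shift j v w)) (trans (st (fs v) (fs w)) (colours-shift (suc j) v w))

  unstable-zero : Fin n → ¬ Stable G⁺ 0
  unstable-zero v st with trans (st fz (fs v)) (apex-apart 0 v)
  ... | ()

WL₁-shift : ∀ {n m} (G : Graph n) (H : Graph m) →
  ¬ Stable H 0 → (∀ j → Stable G j → Stable H (suc j)) → (∀ j → Stable H (suc j) → Stable G j) →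
  ∀ k → WL₁≡ G k → WL₁≡ H (suc k)
WL₁-shift G H unstable₀ up down k (stable , minimal) = up k stable , earlier
  where
  earlier : ∀ j → j < suc k → ¬ Stable H j
  earlier zero    _         = unstable₀
  earlier (suc j) (s≤s j<k) = minimal j j<k ∘′ down j

lemma26 : (n : ℕ) → (G : Graph n) → IsLongRefinement G →
    (Σ ℕ λ d → DegSet G d × count (λ v → deg G v ≡ᵇ d) ≢ suc d) →
    Σ (Graph (suc n)) IsLongRefinement
lemma26 n G (k , wl , size) (d , (degrees , (v₀ , _) , _) , notSucD) =
  G⁺ , suc k , WL₁-shift G G⁺ (unstable-zero v₀) stable-up stable-down k wl , cong suc size
  where
  lowDegree : Fin n → Bool
  lowDegree v = deg G v ≡ᵇ d

  uniform : ∀ v → deg (addApex G lowDegree) (fs v) ≡ suc d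
  uniform v with degrees v
  ... | inj₁ e rewrite deg-old G lowDegree v | e | ≡ᵇ-complete {d} refl = refl
  ... | inj₂ e rewrite deg-old G lowDegree v | e | ≡ᵇ-false (1+n≢n {d}) = refl

  open ApexShift G lowDegree (suc d) uniform
    (λ e → notSucD (trans (≡-sym (deg-apex G lowDegree)) e))
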